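{- Let $M$ be a matroid on ground set $E$ and let $B_1<B_2<\dots<B_n$ be an ordering of all bases of $M$ such that for every $i=1,\dots,n$ there exists a function $\ell_i:E\to\mathbb{R}$ with $\ell_i(B_j)<\ell_i(B_i)$ if and only if $j<i$. Then this order is a shelling order of the independence complex $\mathcal{I}(M)$, and the restriction set $\mathcal{R}(B_i)$ of $B_i$ equals $IP_{\ell_i}(B_i)$ for every $i$.
   Context: For $\ell:E\to\mathbb{R}$ and $A\subseteq E$, $\ell(A)=\sum_{a\in A}\ell(a)$. For a basis $B$, $IP_{\ell}(B)$ is the internally passive set of $B$ with respect to the order on $E$ induced by $\ell$: the set of $b\in B$ for which there exists $b'\in E\setminus B$ with $\ell(b')<\ell(b)$ and $(B\setminus\{b\})\cup\{b'\}$ a basis. A shelling order of a pure simplicial complex is an order $F_1<\dots<F_k$ of its facets such that for $j\ge 2$, $\langle F_1,\dots,F_{j-1}\rangle\cap\langle F_j\rangle$ is pure of dimension $\dim F_j-1$; the restriction set $\mathcal{R}(F_j)$ is the unique subset of $F_j$ such that the faces of $\langle F_1,\dots,F_j\rangle$ not in $\langle F_1,\dots,F_{j-1}\rangle$ are exactly the subsets of $F_j$ containing $\mathcal{R}(F_j)$. -}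

module Defs where

open import Level using (Level; _⊔_; suc)
import Data.Nat
open import Data.Nat using (ℕ; zero; _+_)
open import Data.Bool using (true; false)
import Data.Fin as Fin
open import Data.Fin using (Fin; toℕ; _<_)
open import Data.Fin.Subset using (Subset; _∈_; _∉_; _⊆_; _∪_; _-_; ⁅_⁆; ∣_∣)
open import Data.Vec using (Vec; []; _∷_)
open import Data.Product using (Σ; ∃; _×_; _,_)
open import Relation.Binary.PropositionalEquality using (_≡_)
open import Relation.Binary.Structures using (IsStrictTotalOrder)
open import Algebra.Bundles using (AbelianGroup)
open import Function.Bundles using (_⇔_)
open import Relation.Nullary using (¬_)

-- Totally ordered abelian groups (the real numbers ℝ are an instance).
-- Weights ℓ : E → ℝ in the paper are taken in an arbitrary such group.

record OrderedAbelianGroup (c ℓ₁ ℓ₂ : Level) : Set (Level.suc (c ⊔ ℓ₁ ⊔ ℓ₂)) where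
  field
    abelianGroup : AbelianGroup c ℓ₁
  open AbelianGroup abelianGroup public
  infix 4 _<ᵍ_
  field
    _<ᵍ_ : Carrier → Carrier → Set ℓ₂
    isStrictTotalOrder : IsStrictTotalOrder _≈_ _<ᵍ_
    +-mono-< : ∀ {x y} z → x <ᵍ y → (x ∙ z) <ᵍ (y ∙ z)

record Matroid (m : ℕ) : Set₁ where
  field
    IsBasis : Subset m → Set
    basis-nonempty : ∃ λ B → IsBasis B
    exchange : ∀ {B₁ B₂} → IsBasis B₁ → IsBasis B₂ →
               ∀ {x} → x ∈ B₁ → x ∉ B₂ →
               ∃ λ y → y ∈ B₂ × y ∉ B₁ × IsBasis ((B₁ - x) ∪ ⁅ y ⁆)

open Matroid public

IndepComplex : ∀ {m} → Matroid m → Subset m → Set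
IndepComplex M X = ∃ λ B → IsBasis M B × X ⊆ B

module _ {c ℓ₁ ℓ₂} (G : OrderedAbelianGroup c ℓ₁ ℓ₂) where
  open OrderedAbelianGroup G using (Carrier; _∙_; ε; _<ᵍ_)

  weight : ∀ {m} → (Fin m → Carrier) → Subset m → Carrier
  weight {zero} ℓ [] = ε
  weight {ℕ.suc m} ℓ (true ∷ A) = ℓ Fin.zero ∙ weight (λ i → ℓ (Fin.suc i)) A
  weight {ℕ.suc m} ℓ (false ∷ A) = weight (λ i → ℓ (Fin.suc i)) A

  InternallyPassive : ∀ {m} → Matroid m → (Fin m → Carrier) → Subset m → Fin m → Set ℓ₂
  InternallyPassive M ℓ B b =
    b ∈ B × ∃ λ b' → b' ∉ B × ℓ b' <ᵍ ℓ b × IsBasis M ((B - b) ∪ ⁅ b' ⁆)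

Complex : ℕ → Set₁
Complex m = Subset m → Set

IsFacet : ∀ {m} → Complex m → Subset m → Set
IsFacet Δ X = Δ X × (∀ Y → Δ Y → X ⊆ Y → Y ≡ X)

GeneratedBefore : ∀ {m n} → (Fin n → Subset m) → Fin n → Complex m
GeneratedBefore F j X = ∃ λ i → i < j × X ⊆ F i

GeneratedUpTo : ∀ {m n} → (Fin n → Subset m) → Fin n → Complex m
GeneratedUpTo F j X = ∃ λ i → toℕ i Data.Nat.≤ toℕ j × X ⊆ F i

Generated : ∀ {m} → Subset m → Complex m
Generated F X = X ⊆ F

-- F₁ < … < Fₙ is a shelling order of Δ: it lists each facet of Δ
-- exactly once, and for j ≥ 2, ⟨F_1..F_{j-1}⟩ ∩ ⟨F_j⟩ is pure of
-- dimension dim F_j - 1 (facets of cardinality ∣F_j∣ - 1).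
IsShellingOrder : ∀ {m n} → Complex m → (Fin n → Subset m) → Set
IsShellingOrder {n = n} Δ F =
  (∀ i j → F i ≡ F j → i ≡ j) ×
  (∀ i → IsFacet Δ (F i)) ×
  (∀ X → IsFacet Δ X → ∃ λ i → F i ≡ X) ×
  (∀ j → 1 Data.Nat.≤ toℕ j →
     ∀ X → IsFacet (λ Y → GeneratedBefore F j Y × Generated (F j) Y) X →
       ∣ X ∣ + 1 ≡ ∣ F j ∣)

-- The restriction set of F_j (w.r.t. the order F) equals R (given as a
-- predicate on E): R ⊆ F_j and the faces of ⟨F_1..F_j⟩ not in
-- ⟨F_1..F_{j-1}⟩ are exactly the subsets of F_j containing R.
-- (Such R is unique, so this says 𝓡(F_j) = R.)
RestrictionSetIs : ∀ {m n} {a} → (Fin n → Subset m) → Fin n → (Fin m → Set a) → Set a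
RestrictionSetIs F j R =
  (∀ x → R x → x ∈ F j) ×
  (∀ X → (GeneratedUpTo F j X × ¬ GeneratedBefore F j X) ⇔
         (X ⊆ F j × (∀ x → R x → x ∈ X)))

module Submission where

-- Key fact (lighter-basis-has-passive): if a basis B' is ℓ-lighter than a basis
-- B, some b ∈ B ∖ B' is ℓ-internally passive in B.  Induction on ∣B' ∖ B∣: take
-- the ℓ-lightest b' ∈ B' ∖ B and, by dual exchange, b ∈ B ∖ B' with B − b + b'
-- a basis.  If ℓ(b') < ℓ(b) we are done; otherwise put b into B' in place of
-- some z ∈ B' ∖ B: as ℓ(b) ≤ ℓ(b') ≤ ℓ(z) this basis is still lighter than B,
-- and closer to it.  Conversely, exchanging a passive element of Bᵢ lowers ℓᵢ,
-- so yields an earlier basis.  Hence a face of Bᵢ lies in an earlier basis iff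
-- it misses a passive element: this is the restriction-set statement, and the
-- facets of ⟨B₁ … Bᵢ₋₁⟩ ∩ ⟨Bᵢ⟩ are the sets Bᵢ − b, b passive.

open import Defs
open import Level using (Level)
open import Data.Nat using (ℕ; suc; _+_)
import Data.Nat as ℕ
open import Data.Nat.Properties using (+-comm; m≤n⇒m<n∨m≡n; ≤-refl)
open import Data.Nat.Induction using (<-wellFounded)
open import Induction.WellFounded using (Acc; acc)
open import Data.Bool using (true; false)
open import Data.Fin using (Fin; _<_) renaming (zero to fz; suc to fs)
open import Data.Fin.Properties using (any?; suc-injective; toℕ-injective; _≟_)
open import Data.Fin.Subset
open import Data.Fin.Subset.Properties
open import Data.Vec using (_∷_; here; there)
open import Data.List using (List; filter; allFin)
open import Data.List.Membership.Propositional.Properties using (∈-filter⁺; ∈-allFin)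
open import Data.List.Relation.Unary.All using (lookup)
open import Data.List.Relation.Unary.All.Properties using (all-filter)
open import Data.Product using (∃; _×_; _,_; proj₁; proj₂)
open import Data.Sum using (_⊎_; inj₁; inj₂)
import Data.Sum as Sum
open import Data.Empty using (⊥-elim)
open import Function using (_∘_)
open import Function.Bundles using (_⇔_; mk⇔; Equivalence)
open import Relation.Binary.Bundles using (StrictTotalOrder)
open import Relation.Binary.Definitions using (tri<; tri≈; tri>)
open import Relation.Binary.Structures using (IsStrictTotalOrder)
import Relation.Binary.Properties.StrictTotalOrder as StrictTotalOrderProperties
open import Relation.Binary.PropositionalEquality
  using (_≡_; _≢_; refl; sym; trans; cong; subst; module ≡-Reasoning)
open import Relation.Nullary using (¬_; yes; no)
open import Relation.Nullary.Decidable using (_×-dec_; ¬?; decidable-stable)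
open import Relation.Unary using (Pred; Decidable)
import Relation.Binary.Reasoning.Setoid as SetoidReasoning
import Algebra.Properties.Group as GroupProperties
import Algebra.Properties.CommutativeSemigroup as CommutativeSemigroupProperties

private variable k : ℕ

_[_↦_] : Subset k → Fin k → Fin k → Subset k
B [ b ↦ b' ] = (B - b) ∪ ⁅ b' ⁆

x∈p─q⇒x∉q : ∀ {x} (p q : Subset k) → x ∈ p ─ q → x ∉ q
x∈p─q⇒x∉q (true ∷ p) (false ∷ q) here ()
x∈p─q⇒x∉q (true ∷ p) (true ∷ q) () here
x∈p─q⇒x∉q (_ ∷ p) (_ ∷ q) (there x∈p─q) (there x∈q) = x∈p─q⇒x∉q p q x∈p─q x∈q

∈-remove⁻ : ∀ {x} (p : Subset k) y → x ∈ p - y → x ∈ p × x ≢ y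
∈-remove⁻ p y x∈p-y =
  p─q⊆p p ⁅ y ⁆ x∈p-y , λ { refl → x∈p─q⇒x∉q p ⁅ y ⁆ x∈p-y (x∈⁅x⁆ y) }

-- Extensional descriptions of removal from a subset a ∷ p (removal is not
-- computed structurally, so these are proved by antisymmetry of ⊆).
remove-zero : ∀ a (p : Subset k) → (a ∷ p) - fz ≡ false ∷ p
remove-zero a p = ⊆-antisym ⊆false∷p false∷p⊆
  where
  ⊆false∷p : (a ∷ p) - fz ⊆ false ∷ p
  ⊆false∷p {fz} x∈ = ⊥-elim (proj₂ (∈-remove⁻ (a ∷ p) fz x∈) refl)
  ⊆false∷p {fs x} x∈ = there (drop-there (p─q⊆p (a ∷ p) _ x∈))
  false∷p⊆ : false ∷ p ⊆ (a ∷ p) - fz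
  false∷p⊆ (there x∈p) = x∈p∧x≢y⇒x∈p-y {p = a ∷ p} {y = fz} (there x∈p) (λ ())

remove-suc : ∀ a (p : Subset k) y → (a ∷ p) - fs y ≡ a ∷ (p - y)
remove-suc a p y = ⊆-antisym ⊆a∷p-y a∷p-y⊆
  where
  ⊆a∷p-y : (a ∷ p) - fs y ⊆ a ∷ (p - y)
  ⊆a∷p-y {fz} x∈ with p─q⊆p (a ∷ p) _ x∈
  ... | here = here
  ⊆a∷p-y {fs x} x∈ with ∈-remove⁻ (a ∷ p) (fs y) x∈
  ... | there x∈p , x≢y = there (x∈p∧x≢y⇒x∈p-y x∈p (x≢y ∘ cong fs))
  a∷p-y⊆ : a ∷ (p - y) ⊆ (a ∷ p) - fs y
  a∷p-y⊆ here = x∈p∧x≢y⇒x∈p-y {p = a ∷ p} {y = fs y} here (λ ())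
  a∷p-y⊆ (there x∈p-y) with ∈-remove⁻ p y x∈p-y
  ... | x∈p , x≢y =
    x∈p∧x≢y⇒x∈p-y {p = a ∷ p} {y = fs y} (there x∈p) (x≢y ∘ suc-injective)

∣p-x∣+1≡∣p∣ : ∀ (p : Subset k) x → x ∈ p → ∣ p - x ∣ + 1 ≡ ∣ p ∣
∣p-x∣+1≡∣p∣ (true ∷ p) fz here =
  trans (cong (λ X → ∣ X ∣ + 1) (remove-zero true p)) (+-comm ∣ p ∣ 1)
∣p-x∣+1≡∣p∣ (true ∷ p) (fs x) (there x∈p) =
  trans (cong (λ X → ∣ X ∣ + 1) (remove-suc true p x)) (cong suc (∣p-x∣+1≡∣p∣ p x x∈p))
∣p-x∣+1≡∣p∣ (false ∷ p) (fs x) (there x∈p) =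
  trans (cong (λ X → ∣ X ∣ + 1) (remove-suc false p x)) (∣p-x∣+1≡∣p∣ p x x∈p)

⊆-remove : ∀ {X B : Subset k} {x} → X ⊆ B → x ∉ X → X ⊆ B - x
⊆-remove X⊆B x∉X y∈X = x∈p∧x≢y⇒x∈p-y (X⊆B y∈X) (λ { refl → x∉X y∈X })

∈-replace⁻ : ∀ {x} (B : Subset k) b b' → x ∈ B [ b ↦ b' ] → (x ∈ B × x ≢ b) ⊎ x ≡ b'
∈-replace⁻ B b b' x∈ =
  Sum.map (∈-remove⁻ B b) (x∈⁅y⁆⇒x≡y b') (x∈p∪q⁻ (B - b) ⁅ b' ⁆ x∈)

∈-replace⁺ : ∀ {x} {B : Subset k} {b} b' → x ∈ B → x ≢ b → x ∈ B [ b ↦ b' ]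
∈-replace⁺ b' x∈B x≢b = x∈p∪q⁺ (inj₁ (x∈p∧x≢y⇒x∈p-y x∈B x≢b))

new∈replace : ∀ (B : Subset k) b b' → b' ∈ B [ b ↦ b' ]
new∈replace B b b' = x∈p∪q⁺ (inj₂ (x∈⁅x⁆ b'))

remove⊆replace : ∀ (B : Subset k) b b' → B - b ⊆ B [ b ↦ b' ]
remove⊆replace B b b' = p⊆p∪q ⁅ b' ⁆

∉-replace : ∀ {x} {B : Subset k} {b b'} → x ≢ b → x ∉ B [ b ↦ b' ] → x ∉ B
∉-replace x≢b x∉ x∈B = x∉ (∈-replace⁺ _ x∈B x≢b)

replace-involutive : ∀ {B : Subset k} {x y} → y ∈ B → x ∉ B → B [ y ↦ x ] [ x ↦ y ] ≡ B
replace-involutive {B = B} {x} {y} y∈B x∉B = ⊆-antisym ⊆B B⊆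
  where
  ⊆B : B [ y ↦ x ] [ x ↦ y ] ⊆ B
  ⊆B p∈ with ∈-replace⁻ (B [ y ↦ x ]) x y p∈
  ... | inj₂ refl = y∈B
  ... | inj₁ (p∈B' , p≢x) with ∈-replace⁻ B y x p∈B'
  ...   | inj₁ (p∈B , _) = p∈B
  ...   | inj₂ p≡x = ⊥-elim (p≢x p≡x)
  B⊆ : B ⊆ B [ y ↦ x ] [ x ↦ y ]
  B⊆ {p} p∈B with p ≟ y
  ... | yes refl = new∈replace _ x p
  ... | no p≢y = ∈-replace⁺ y (∈-replace⁺ x p∈B p≢y) (λ { refl → x∉B p∈B })

replace-closer : ∀ {B B' : Subset k} {z w} → z ∈ B' → z ∉ B → w ∈ B →
                 ∣ B' [ z ↦ w ] ─ B ∣ ℕ.< ∣ B' ─ B ∣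
replace-closer {B = B} {B'} {z} {w} z∈B' z∉B w∈B =
  p⊂q⇒∣p∣<∣q∣ (shrinks , z , x∈p∧x∉q⇒x∈p─q z∈B' z∉B , z∉B'' ∘ p─q⊆p _ B)
  where
  shrinks : B' [ z ↦ w ] ─ B ⊆ B' ─ B
  shrinks p∈ with ∈-replace⁻ B' z w (p─q⊆p _ B p∈)
  ... | inj₁ (p∈B' , _) = x∈p∧x∉q⇒x∈p─q p∈B' (x∈p─q⇒x∉q _ B p∈)
  ... | inj₂ refl = ⊥-elim (x∈p─q⇒x∉q _ B p∈ w∈B)
  z∉B'' : z ∉ B' [ z ↦ w ]
  z∉B'' z∈ with ∈-replace⁻ B' z w z∈
  ... | inj₁ (_ , z≢z) = z≢z refl
  ... | inj₂ refl = z∉B w∈B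

⊆-or-outside : ∀ (A C : Subset k) → A ⊆ C ⊎ ∃ λ x → x ∈ A × x ∉ C
⊆-or-outside A C with any? (λ x → (x ∈? A) ×-dec ¬? (x ∈? C))
... | yes found = inj₂ found
... | no none = inj₁ λ {x} x∈A → decidable-stable (x ∈? C) (λ x∉C → none (x , x∈A , x∉C))

module Weights {c ℓ₁ ℓ₂ : Level} (G : OrderedAbelianGroup c ℓ₁ ℓ₂) where
  open OrderedAbelianGroup G
    using (Carrier; _≈_; _∙_; _⁻¹; _<ᵍ_; isStrictTotalOrder; +-mono-<; ∙-cong; ∙-congˡ;
           comm; group; commutativeSemigroup; reflexive; setoid)
    renaming (refl to ≈-refl; sym to ≈-sym; trans to ≈-trans)
  open IsStrictTotalOrder isStrictTotalOrder
    using (compare; irrefl; asym; <-respˡ-≈; <-respʳ-≈) renaming (trans to <-trans)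
  open GroupProperties group using (//-rightDividesʳ; ∙-cancelʳ)
  open CommutativeSemigroupProperties commutativeSemigroup using (x∙yz≈y∙xz; xy∙z≈zy∙x)

  W : ∀ {m} → (Fin m → Carrier) → Subset m → Carrier
  W = weight G

  _≼_ : Carrier → Carrier → Set ℓ₂
  x ≼ y = ¬ (y <ᵍ x)

  ≼-trans : ∀ {x y z} → x ≼ y → y ≼ z → x ≼ z
  ≼-trans {x} {y} {z} x≼y y≼z z<x with compare x y
  ... | tri< x<y _ _ = y≼z (<-trans z<x x<y)
  ... | tri≈ _ x≈y _ = y≼z (<-respʳ-≈ x≈y z<x)
  ... | tri> _ _ y<x = x≼y y<x

  ≼-<-trans : ∀ {x y z} → x ≼ y → y <ᵍ z → x <ᵍ z
  ≼-<-trans {x} {y} x≼y y<z with compare x y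
  ... | tri< x<y _ _ = <-trans x<y y<z
  ... | tri≈ _ x≈y _ = <-respˡ-≈ (≈-sym x≈y) y<z
  ... | tri> _ _ y<x = ⊥-elim (x≼y y<x)

  ∙-cancelʳ-< : ∀ {u v} p → u ∙ p <ᵍ v ∙ p → u <ᵍ v
  ∙-cancelʳ-< {u} {v} p up<vp =
    <-respʳ-≈ (//-rightDividesʳ p v) (<-respˡ-≈ (//-rightDividesʳ p u) (+-mono-< (p ⁻¹) up<vp))

  balance-< : ∀ {u v p q} → u ∙ p ≈ v ∙ q → q <ᵍ p → u <ᵍ v
  balance-< {u} {v} {p} {q} up≈vq q<p =
    ∙-cancelʳ-< p (<-respˡ-≈ (≈-sym up≈vq)
                  (<-respʳ-≈ (comm p v) (<-respˡ-≈ (comm q v) (+-mono-< v q<p))))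

  balance-≼ : ∀ {u v p q} → u ∙ p ≈ v ∙ q → q ≼ p → u ≼ v
  balance-≼ {u} {v} {p} {q} up≈vq q≼p with compare q p
  ... | tri< q<p _ _ = asym (balance-< up≈vq q<p)
  ... | tri≈ _ q≈p _ = irrefl (≈-sym (∙-cancelʳ p u v (≈-trans up≈vq (∙-congˡ q≈p))))
  ... | tri> _ _ p<q = ⊥-elim (q≼p p<q)

  weight-insert : ∀ {m} (ℓ : Fin m → Carrier) A x → x ∉ A →
                  W ℓ (A ∪ ⁅ x ⁆) ≈ ℓ x ∙ W ℓ A
  weight-insert ℓ (true ∷ A) fz x∉A = ⊥-elim (x∉A here)
  weight-insert ℓ (false ∷ A) fz x∉A = ∙-congˡ (reflexive (cong (W (ℓ ∘ fs)) (∪-identityʳ A)))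
  weight-insert ℓ (true ∷ A) (fs x) x∉A =
    ≈-trans (∙-congˡ (weight-insert (ℓ ∘ fs) A x (x∉A ∘ there))) (x∙yz≈y∙xz _ _ _)
  weight-insert ℓ (false ∷ A) (fs x) x∉A = weight-insert (ℓ ∘ fs) A x (x∉A ∘ there)

  weight-remove : ∀ {m} (ℓ : Fin m → Carrier) A x → x ∈ A → W ℓ A ≈ ℓ x ∙ W ℓ (A - x)
  weight-remove ℓ (true ∷ A) fz here =
    reflexive (cong (λ X → ℓ fz ∙ W ℓ X) (sym (remove-zero true A)))
  weight-remove ℓ (true ∷ A) (fs x) (there x∈A) rewrite remove-suc true A x =
    ≈-trans (∙-congˡ (weight-remove (ℓ ∘ fs) A x x∈A)) (x∙yz≈y∙xz _ _ _)
  weight-remove ℓ (false ∷ A) (fs x) (there x∈A) rewrite remove-suc false A x =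
    weight-remove (ℓ ∘ fs) A x x∈A

  weight-replace : ∀ {m} (ℓ : Fin m → Carrier) B b b' → b ∈ B → b' ∉ B →
                   W ℓ (B [ b ↦ b' ]) ∙ ℓ b ≈ W ℓ B ∙ ℓ b'
  weight-replace ℓ B b b' b∈B b'∉B = begin
    W ℓ ((B - b) ∪ ⁅ b' ⁆) ∙ ℓ b  ≈⟨ ∙-cong (weight-insert ℓ (B - b) b' b'∉B-b) ≈-refl ⟩
    (ℓ b' ∙ W ℓ (B - b)) ∙ ℓ b   ≈⟨ xy∙z≈zy∙x _ _ _ ⟩
    (ℓ b ∙ W ℓ (B - b)) ∙ ℓ b'   ≈⟨ ∙-cong (≈-sym (weight-remove ℓ B b b∈B)) ≈-refl ⟩
    W ℓ B ∙ ℓ b'                 ∎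
    where
    open SetoidReasoning setoid
    b'∉B-b : b' ∉ B - b
    b'∉B-b = b'∉B ∘ proj₁ ∘ ∈-remove⁻ B b

  minimum : ∀ {m} (f : Fin m → Carrier) (Q : Pred (Fin m) Level.zero) → Decidable Q → ∃ Q →
            ∃ λ x → Q x × ∀ y → Q y → f x ≼ f y
  minimum {m} f Q Q? (x₀ , Qx₀) =
    argmin f x₀ xs , argmin-all f Qx₀ (all-filter Q? (allFin m)) ,
    λ y Qy → ≤⇒≼ (lookup (f[argmin]≤f[xs] x₀ xs) (∈-filter⁺ Q? (∈-allFin y) Qy))
    where
    strictTotalOrder : StrictTotalOrder c ℓ₁ ℓ₂
    strictTotalOrder = record { isStrictTotalOrder = isStrictTotalOrder }
    open StrictTotalOrderProperties strictTotalOrder using (totalOrder)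
    open import Data.List.Extrema totalOrder using (argmin; argmin-all; f[argmin]≤f[xs])
    xs : List (Fin m)
    xs = filter Q? (allFin m)
    ≤⇒≼ : ∀ {x y} → x <ᵍ y ⊎ x ≈ y → x ≼ y
    ≤⇒≼ (inj₁ x<y) = asym x<y
    ≤⇒≼ (inj₂ x≈y) = irrefl (≈-sym x≈y)

module Bases {m : ℕ} (M : Matroid m) where

  basis-⊆-basis : ∀ {A C} → IsBasis M A → IsBasis M C → A ⊆ C → A ≡ C
  basis-⊆-basis {A} {C} bA bC A⊆C with ⊆-or-outside C A
  ... | inj₁ C⊆A = ⊆-antisym A⊆C C⊆A
  ... | inj₂ (x , x∈C , x∉A) =
    let (y , y∈A , y∉C , _) = exchange M bC bA x∈C x∉A in ⊥-elim (y∉C (A⊆C y∈A))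

  basis-facet : ∀ {X} → IsBasis M X → IsFacet (IndepComplex M) X
  basis-facet {X} bX = (X , bX , λ x∈X → x∈X) , λ { Y (C , bC , Y⊆C) X⊆Y →
    let X≡C = basis-⊆-basis bX bC (Y⊆C ∘ X⊆Y)
    in ⊆-antisym (λ y∈Y → subst (_ ∈_) (sym X≡C) (Y⊆C y∈Y)) X⊆Y }

  facet-basis : ∀ {X} → IsFacet (IndepComplex M) X → IsBasis M X
  facet-basis ((C , bC , X⊆C) , maximal) =
    subst (IsBasis M) (maximal C (C , bC , λ c∈C → c∈C) X⊆C) bC

  -- By induction on ∣B₂ ∖ B₁∣: while B₂ ∖ B₁ contains some z ≠ y, exchange z out
  -- of B₂ (keeping y); once B₂ ∖ B₁ = {y}, exchanging y out of B₂ for some x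
  -- yields a basis inside B₁, hence B₁ itself, so B₁[x ↦ y] = B₂.
  dual-exchange : ∀ {B₁ B₂} → IsBasis M B₁ → IsBasis M B₂ →
                  ∀ {y} → y ∈ B₂ → y ∉ B₁ →
                  ∃ λ x → x ∈ B₁ × x ∉ B₂ × IsBasis M (B₁ [ x ↦ y ])
  dual-exchange {B₁} b₁ = go (<-wellFounded _)
    where
    go : ∀ {B₂} → Acc ℕ._<_ ∣ B₂ ─ B₁ ∣ → IsBasis M B₂ →
         ∀ {y} → y ∈ B₂ → y ∉ B₁ →
         ∃ λ x → x ∈ B₁ × x ∉ B₂ × IsBasis M (B₁ [ x ↦ y ])
    go {B₂} (acc closer) b₂ {y} y∈B₂ y∉B₁
      with any? (λ z → ((z ∈? B₂) ×-dec ¬? (z ∈? B₁)) ×-dec ¬? (z ≟ y))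
    ... | yes (z , (z∈B₂ , z∉B₁) , z≢y) with exchange M b₂ b₁ z∈B₂ z∉B₁
    ...   | w , w∈B₁ , _ , b₃
      with go (closer (replace-closer z∈B₂ z∉B₁ w∈B₁)) b₃
              (∈-replace⁺ w y∈B₂ (z≢y ∘ sym)) y∉B₁
    ...     | x , x∈B₁ , x∉B₃ , b =
      x , x∈B₁ , ∉-replace (λ { refl → z∉B₁ x∈B₁ }) x∉B₃ , b
    go {B₂} (acc closer) b₂ {y} y∈B₂ y∉B₁ | no only-y with exchange M b₂ b₁ y∈B₂ y∉B₁
    ...   | x , x∈B₁ , x∉B₂ , b₄ =
      x , x∈B₁ , x∉B₂ , subst (IsBasis M) B₂≡B₁[x↦y] b₂
      where
      B₄⊆B₁ : B₂ [ y ↦ x ] ⊆ B₁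
      B₄⊆B₁ {p} p∈B₄ with ∈-replace⁻ B₂ y x p∈B₄
      ... | inj₂ refl = x∈B₁
      ... | inj₁ (p∈B₂ , p≢y) =
        decidable-stable (p ∈? B₁) (λ p∉B₁ → only-y (p , (p∈B₂ , p∉B₁) , p≢y))
      B₂≡B₁[x↦y] : B₂ ≡ B₁ [ x ↦ y ]
      B₂≡B₁[x↦y] = begin
        B₂                     ≡⟨ sym (replace-involutive y∈B₂ x∉B₂) ⟩
        B₂ [ y ↦ x ] [ x ↦ y ] ≡⟨ cong (_[ x ↦ y ]) (basis-⊆-basis b₄ b₁ B₄⊆B₁) ⟩
        B₁ [ x ↦ y ]           ∎
        where open ≡-Reasoning

module Passivity {c ℓ₁ ℓ₂ : Level} (G : OrderedAbelianGroup c ℓ₁ ℓ₂)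
                 {m : ℕ} (M : Matroid m) where
  open OrderedAbelianGroup G using (Carrier; _<ᵍ_; isStrictTotalOrder) renaming (refl to ≈-refl)
  open IsStrictTotalOrder isStrictTotalOrder using (irrefl; _<?_)
  open Weights G
  open Bases M

  replace-lighter : ∀ (ℓ : Fin m → Carrier) {B b b'} → b ∈ B → b' ∉ B → ℓ b' <ᵍ ℓ b →
                    W ℓ (B [ b ↦ b' ]) <ᵍ W ℓ B
  replace-lighter ℓ {B} {b} {b'} b∈B b'∉B b'<b = balance-< (weight-replace ℓ B b b' b∈B b'∉B) b'<b

  lighter-basis-has-passive : ∀ (ℓ : Fin m → Carrier) {B B'} → IsBasis M B → IsBasis M B' →
                              W ℓ B' <ᵍ W ℓ B →
                              ∃ λ b → b ∉ B' × InternallyPassive G M ℓ B b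
  lighter-basis-has-passive ℓ {B} bB = go (<-wellFounded _)
    where
    go : ∀ {B'} → Acc ℕ._<_ ∣ B' ─ B ∣ → IsBasis M B' → W ℓ B' <ᵍ W ℓ B →
         ∃ λ b → b ∉ B' × InternallyPassive G M ℓ B b
    go {B'} (acc closer) bB' B'<B with ⊆-or-outside B' B
    ... | inj₁ B'⊆B =
      ⊥-elim (irrefl ≈-refl (subst (λ X → W ℓ X <ᵍ W ℓ B) (basis-⊆-basis bB' bB B'⊆B) B'<B))
    ... | inj₂ B'∖B-nonempty
      with minimum ℓ (λ y → y ∈ B' × y ∉ B) (λ y → (y ∈? B') ×-dec ¬? (y ∈? B))
                   B'∖B-nonempty
    ... | b' , (b'∈B' , b'∉B) , b'-lightest with dual-exchange bB bB' b'∈B' b'∉B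
    ... | b , b∈B , b∉B' , B[b↦b'] with ℓ b' <? ℓ b
    ... | yes b'<b = b , b∉B' , b∈B , b' , b'∉B , b'<b , B[b↦b']
    ... | no b≼b' with dual-exchange bB' bB b∈B b∉B'
    ... | z , z∈B' , z∉B , B'[z↦b]
      with go (closer (replace-closer z∈B' z∉B b∈B)) B'[z↦b] lighter
      where
      lighter : W ℓ (B' [ z ↦ b ]) <ᵍ W ℓ B
      lighter = ≼-<-trans (balance-≼ (weight-replace ℓ B' z b z∈B' b∉B')
                                      (≼-trans b≼b' (b'-lightest z (z∈B' , z∉B))))
                          B'<B
    ... | c , c∉B'' , c-passive =
      c , ∉-replace (λ { refl → z∉B (proj₁ c-passive) }) c∉B'' , c-passive

before-downward : ∀ {m n} (F : Fin n → Subset m) j {X Y} → X ⊆ Y →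
                  GeneratedBefore F j Y → GeneratedBefore F j X
before-downward F j X⊆Y (i , i<j , Y⊆Fi) = i , i<j , Y⊆Fi ∘ X⊆Y

new-face-⊆ : ∀ {m n} (F : Fin n → Subset m) j {X} → GeneratedUpTo F j X →
             ¬ GeneratedBefore F j X → X ⊆ F j
new-face-⊆ F j (i , i≤j , X⊆Fi) not-before with m≤n⇒m<n∨m≡n i≤j
... | inj₁ i<j = ⊥-elim (not-before (i , i<j , X⊆Fi))
... | inj₂ i≡j rewrite toℕ-injective i≡j = X⊆Fi

-- The hypotheses of Lemma 6.1 (distinctness of the Bᵢ aside), as parameters.
module Shelling {c ℓ₁ ℓ₂ : Level} (G : OrderedAbelianGroup c ℓ₁ ℓ₂) {m n : ℕ}
  (M : Matroid m) (B : Fin n → Subset m)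
  (bases : ∀ i → IsBasis M (B i))
  (all-bases : ∀ X → IsBasis M X → ∃ λ i → B i ≡ X)
  (ℓ : Fin n → Fin m → OrderedAbelianGroup.Carrier G)
  (separating : ∀ i j → OrderedAbelianGroup._<ᵍ_ G (weight G (ℓ i) (B j)) (weight G (ℓ i) (B i))
                         ⇔ (j < i))
  where
  open OrderedAbelianGroup G using (_<ᵍ_)
  open Weights G using (W)
  open Passivity G M

  Passive : Fin n → Fin m → Set ℓ₂
  Passive i = InternallyPassive G M (ℓ i) (B i)

  earlier-misses-passive : ∀ {i k} → k < i → ∃ λ b → b ∉ B k × Passive i b
  earlier-misses-passive {i} {k} k<i =
    lighter-basis-has-passive (ℓ i) (bases i) (bases k) (Equivalence.from (separating i k) k<i)

  -- Dropping a passive element b from Bᵢ gives a face of an earlier basis,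
  -- namely of Bᵢ[b ↦ b'], which is ℓᵢ-lighter than Bᵢ.
  passive-removal-earlier : ∀ {i b} → Passive i b → GeneratedBefore B i (B i - b)
  passive-removal-earlier {i} {b} (b∈Bi , b' , b'∉Bi , b'<b , exchanged) with all-bases _ exchanged
  ... | k , Bk≡ = k , Equivalence.to (separating i k) Bk-lighter ,
                  subst (B i - b ⊆_) (sym Bk≡) (remove⊆replace (B i) b b')
    where
    Bk-lighter : W (ℓ i) (B k) <ᵍ W (ℓ i) (B i)
    Bk-lighter = subst (λ X → W (ℓ i) X <ᵍ W (ℓ i) (B i)) (sym Bk≡)
                       (replace-lighter (ℓ i) b∈Bi b'∉Bi b'<b)

  -- Facets of ⟨B₁ … B_{j−1}⟩ ∩ ⟨B_j⟩ are the sets B_j − b with b passive.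
  shelling-step : ∀ j X → IsFacet (λ Y → GeneratedBefore B j Y × Generated (B j) Y) X →
                  ∣ X ∣ + 1 ≡ ∣ B j ∣
  shelling-step j X (((k , k<j , X⊆Bk) , X⊆Bj) , maximal) with earlier-misses-passive k<j
  ... | b , b∉Bk , passive = begin
    ∣ X ∣ + 1         ≡⟨ cong (λ Y → ∣ Y ∣ + 1) (sym Bj-b≡X) ⟩
    ∣ B j - b ∣ + 1   ≡⟨ ∣p-x∣+1≡∣p∣ (B j) b (proj₁ passive) ⟩
    ∣ B j ∣           ∎
    where
    open ≡-Reasoning
    Bj-b≡X : B j - b ≡ X
    Bj-b≡X = maximal (B j - b) (passive-removal-earlier passive , p─q⊆p (B j) ⁅ b ⁆)
                     (⊆-remove X⊆Bj (b∉Bk ∘ X⊆Bk))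

  restriction : ∀ i → RestrictionSetIs B i (Passive i)
  restriction i = (λ _ → proj₁) , λ X → mk⇔ new⇒contains-passive contains-passive⇒new
    where
    new⇒contains-passive : ∀ {X} → GeneratedUpTo B i X × ¬ GeneratedBefore B i X →
                           X ⊆ B i × (∀ x → Passive i x → x ∈ X)
    new⇒contains-passive {X} (up-to , not-before) = X⊆Bi , λ x passive →
      decidable-stable (x ∈? X) (λ x∉X →
        not-before (before-downward B i (⊆-remove X⊆Bi x∉X) (passive-removal-earlier passive)))
      where
      X⊆Bi : X ⊆ B i
      X⊆Bi = new-face-⊆ B i up-to not-before
    contains-passive⇒new : ∀ {X} → X ⊆ B i × (∀ x → Passive i x → x ∈ X) →
                           GeneratedUpTo B i X × ¬ GeneratedBefore B i X
    contains-passive⇒new (X⊆Bi , contains) = (i , ≤-refl , X⊆Bi) , λ (k , k<i , X⊆Bk) →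
      let (b , b∉Bk , passive) = earlier-misses-passive k<i in b∉Bk (X⊆Bk (contains b passive))

lemma6p1 : ∀ {c ℓ₁ ℓ₂} (G : OrderedAbelianGroup c ℓ₁ ℓ₂) {m n : ℕ}
    (M : Matroid m) (B : Fin n → Subset m) →
    (∀ i j → B i ≡ B j → i ≡ j) →
    (∀ i → IsBasis M (B i)) →
    (∀ X → IsBasis M X → ∃ λ i → B i ≡ X) →
    (ℓ : Fin n → Fin m → OrderedAbelianGroup.Carrier G) →
    (∀ i j → OrderedAbelianGroup._<ᵍ_ G (weight G (ℓ i) (B j)) (weight G (ℓ i) (B i)) ⇔ (j < i)) →
    IsShellingOrder (IndepComplex M) B
    × (∀ i → RestrictionSetIs B i (InternallyPassive G M (ℓ i) (B i)))
lemma6p1 G M B distinct bases all-bases ℓ separating =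
  (distinct , (λ i → basis-facet (bases i)) , facets-listed , λ j _ → shelling-step j) , restriction
  where
  open Bases M using (basis-facet; facet-basis)
  open Shelling G M B bases all-bases ℓ separating using (shelling-step; restriction)
  facets-listed : ∀ X → IsFacet (IndepComplex M) X → ∃ λ i → B i ≡ X
  facets-listed X facet = all-bases X (facet-basis facet)
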